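{- Let $t\ge 0$ be an integer and $d = 2^t+1$. Let $f:\mathbb{F}_2^d\to\mathbb{F}_2$ be a linear bipermutive local rule $f(x_1,\ldots,x_d)=a_1x_1\oplus\cdots\oplus a_dx_d$ (so $a_1=a_d=1$), with associated polynomial $p_f(X) = a_1 + a_2X + \cdots + a_dX^{d-1}\in\mathbb{F}_2[X]$, and let $F:\mathbb{F}_2^{2(d-1)}\to\mathbb{F}_2^{d-1}$ be the no-boundary cellular automaton with local rule $f$. Then $F$ is self-orthogonal if and only if $p_f(1)\neq 0$.
   Context: For a local rule $f:\mathbb{F}_2^d\to\mathbb{F}_2$, the no-boundary cellular automaton (NBCA) $F:\mathbb{F}_2^{2(d-1)}\to\mathbb{F}_2^{d-1}$ is defined by $F(x_1,\ldots,x_{2(d-1)}) = (f(x_1,\ldots,x_d), f(x_2,\ldots,x_{d+1}),\ldots, f(x_{d-1},\ldots,x_{2(d-1)}))$. The rule $f$ is bipermutive if it is a permutation in the first variable when the others are fixed, and in the last variable when the others are fixed. Let $N = 2^{d-1}$, fix a bijection $\phi:\mathbb{F}_2^{d-1}\to\{1,\ldots,N\}$ with inverse $\psi$. The Cayley table of $F$ is the $N\times N$ matrix $C_F$ with $C_F(i,j) = \phi(F(\psi(i)\|\psi(j)))$ ($\|$ is concatenation); for bipermutive $f$ it is a Latin square. Two Latin squares $L_1,L_2$ of order $N$ are orthogonal if the pairs $(L_1(i,j),L_2(i,j))$ are pairwise distinct over all $(i,j)$. $F$ is self-orthogonal if $C_F$ is orthogonal to its transpose $C_F^\top$. -}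

module Defs where

open import Data.Bool using (Bool; true; false; _xor_; _∧_)
open import Data.Nat using (ℕ; zero; suc; _+_; _^_; _<_; _≤_)
open import Data.Nat.Properties using (+-mono-<-≤)
open import Data.Fin using (Fin; toℕ; fromℕ<)
open import Data.Fin.Properties using (toℕ<n; toℕ≤pred[n])
open import Data.Vec using (Vec; []; _∷_; _∷ʳ_; _++_; lookup; tabulate; zipWith; foldr)
open import Data.List using (List; []; _∷_)
open import Data.Product using (_×_; _,_)
open import Function.Bundles using (_↔_; Inverse)
open import Relation.Binary.PropositionalEquality using (_≡_)

-- 𝔽₂ is modelled by Bool: false = 0, true = 1, _xor_ = ⊕, _∧_ = ·.

-- A local rule of diameter d = suc m.
LocalRule : ℕ → Set
LocalRule m = Vec Bool (suc m) → Bool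

-- Bipermutive: permutation (equivalently injection, on the 2-element set 𝔽₂)
-- in the first variable and in the last variable, the others fixed.
Bipermutive : {m : ℕ} → LocalRule m → Set
Bipermutive {m} f =
  ((x : Vec Bool m) (b b′ : Bool) → f (b ∷ x) ≡ f (b′ ∷ x) → b ≡ b′) ×
  ((x : Vec Bool m) (b b′ : Bool) → f (x ∷ʳ b) ≡ f (x ∷ʳ b′) → b ≡ b′)

linearRule : {m : ℕ} → Vec Bool (suc m) → LocalRule m
linearRule a x = foldr (λ _ → Bool) _xor_ false (zipWith _∧_ a x)

window : {m : ℕ} → Vec Bool (m + m) → Fin m → Vec Bool (suc m)
window {m} x i = tabulate λ j →
  lookup x (fromℕ< {toℕ i + toℕ j} (+-mono-<-≤ (toℕ<n i) (toℕ≤pred[n] j)))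

NBCA : {m : ℕ} → LocalRule m → Vec Bool (m + m) → Vec Bool m
NBCA f x = tabulate λ i → f (window x i)

-- Cayley table of F w.r.t. a bijection φ : 𝔽₂^{d-1} → {1..N} (here Fin N).
Cayley : {m : ℕ} → (Vec Bool m ↔ Fin (2 ^ m)) → (Vec Bool (m + m) → Vec Bool m) →
         Fin (2 ^ m) → Fin (2 ^ m) → Fin (2 ^ m)
Cayley φ F i j = Inverse.to φ (F (Inverse.from φ i ++ Inverse.from φ j))

transpose : {n : ℕ} → (Fin n → Fin n → Fin n) → Fin n → Fin n → Fin n
transpose L i j = L j i

Orthogonal : {n : ℕ} → (Fin n → Fin n → Fin n) → (Fin n → Fin n → Fin n) → Set
Orthogonal L₁ L₂ = ∀ i j i′ j′ →
  (L₁ i j , L₂ i j) ≡ (L₁ i′ j′ , L₂ i′ j′) → (i , j) ≡ (i′ , j′)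

SelfOrthogonal : {m : ℕ} → (Vec Bool m ↔ Fin (2 ^ m)) → (Vec Bool (m + m) → Vec Bool m) → Set
SelfOrthogonal φ F = Orthogonal (Cayley φ F) (transpose (Cayley φ F))

-- Polynomials over 𝔽₂ as coefficient lists (constant term first), Horner evaluation.
polyEval : List Bool → Bool → Bool
polyEval [] x = false
polyEval (c ∷ cs) x = c xor (x ∧ polyEval cs x)

assocPoly : {m : ℕ} → Vec Bool (suc m) → List Bool
assocPoly a = Data.Vec.toList a

-- F is 𝔽₂-linear, so self-orthogonality means that F (x ‖ y) = F (y ‖ x) = 0 forces x = y = 0.
-- Adding the two equations gives F (e ‖ e) = 0 for e = x ⊕ y. Output i of F (e ‖ e) is term i of
-- p_f(σ) applied to the periodic extension of e, σ the left shift; this sequence has period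
-- N = 2^t, so vanishing on the first N outputs makes it vanish identically. By the Frobenius
-- identity p_f(σ)^N = p_f(σ^N), and σ^N acts as the identity on N-periodic sequences, so
-- p_f(1) e = 0. Hence e = 0 when p_f(1) = 1, and then F (x ‖ x) = 0 gives x = 0 as well.
-- Conversely, if p_f(1) = 0 then F (1…1) = 0 = F (0…0), so two diagonal cells collide.
module Submission where

open import Defs
open import Algebra using (CommutativeRing)
import Algebra.Properties.CommutativeSemigroup as CommutativeSemigroupProperties
open import Data.Bool using (Bool; true; false; _xor_; _∧_)
open import Data.Bool.Properties
  using (xor-assoc; xor-same; xor-comm; ∧-distribˡ-xor; ∧-distribʳ-xor; ∧-zeroʳ; ¬-not; xor-∧-commutativeRing)
open import Data.Nat using (ℕ; zero; suc; _+_; _*_; _^_; NonZero; >-nonZero⁻¹)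
open import Data.Nat.Properties
  using (+-mono-<-≤; +-identityʳ; +-assoc; +-comm; +-commutativeSemigroup; m^n≢0)
open import Data.Nat.DivMod using (_%_; _/_; _mod_; m≡m%n+[m/n]*n; [m+n]%n≡m%n; m<n⇒m%n≡m; m%n<n)
import Data.Fin as Fin
open import Data.Fin using (Fin; toℕ; fromℕ<; splitAt; join)
open import Data.Fin.Properties
  using (toℕ<n; toℕ≤pred[n]; toℕ-fromℕ<; fromℕ<-cong; fromℕ<-toℕ; join-splitAt; toℕ-↑ˡ; toℕ-↑ʳ)
open import Data.List using (List; []; _∷_)
open import Data.Product using (_×_; _,_; proj₁; proj₂)
open import Data.Sum using (_⊎_; inj₁; inj₂)
open import Data.Vec using (Vec; []; _∷_; _++_; lookup; tabulate; zipWith; foldr; replicate; toList)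
open import Data.Vec.Properties
  using (lookup∘tabulate; tabulate∘lookup; tabulate-cong; lookup-zipWith; lookup-replicate;
         lookup-++ˡ; lookup-++ʳ; zipWith-++; zipWith-comm; ∷-injectiveˡ; ∷-injectiveʳ)
open import Function.Bundles using (_↔_; _⇔_; Inverse; Injection; mk⇔)
open import Function.Construct.Composition using (_⇔-∘_)
open import Function.Construct.Symmetry using (↔-sym)
open import Function.Properties.Inverse using (↔⇒↣)
open import Relation.Binary.PropositionalEquality
  using (_≡_; _≢_; refl; sym; trans; cong; cong₂; subst; module ≡-Reasoning)
open ≡-Reasoning

private
  module ℕ-+ = CommutativeSemigroupProperties +-commutativeSemigroup
  module 𝔽₂-+ = CommutativeSemigroupProperties
    (CommutativeRing.+-commutativeSemigroup xor-∧-commutativeRing)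

xor≡false⇒≡ : ∀ {x y} → x xor y ≡ false → x ≡ y
xor≡false⇒≡ {false} {false} _ = refl
xor≡false⇒≡ {true}  {true}  _ = refl
xor≡false⇒≡ {false} {true}  ()
xor≡false⇒≡ {true}  {false} ()

xor-cancel-middle : ∀ x y z → (x xor y) xor (y xor z) ≡ x xor z
xor-cancel-middle x y z = begin
  (x xor y) xor (y xor z)   ≡⟨ xor-assoc x y (y xor z) ⟩
  x xor (y xor (y xor z))   ≡⟨ cong (x xor_) (sym (xor-assoc y y z)) ⟩
  x xor ((y xor y) xor z)   ≡⟨ cong (λ w → x xor (w xor z)) (xor-same y) ⟩
  x xor z                   ∎

-- c² = c: this is where the Frobenius identity needs the coefficients to lie in 𝔽₂.
∧-distribˡ-xor-idem : ∀ c x y → c ∧ ((c ∧ x) xor y) ≡ (c ∧ x) xor (c ∧ y)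
∧-distribˡ-xor-idem false x y = refl
∧-distribˡ-xor-idem true  x y = refl

infixl 6 _⊕_

_⊕_ : ∀ {n} → Vec Bool n → Vec Bool n → Vec Bool n
_⊕_ = zipWith _xor_

zeros : ∀ {n} → Vec Bool n
zeros {n} = replicate n false

lookup-extensional : ∀ {A : Set} {n} {u v : Vec A n} → (∀ i → lookup u i ≡ lookup v i) → u ≡ v
lookup-extensional {u = u} {v} u≗v =
  trans (sym (tabulate∘lookup u)) (trans (tabulate-cong u≗v) (tabulate∘lookup v))

replicate-injective : ∀ {A : Set} {n} .{{_ : NonZero n}} {x y : A} → replicate n x ≡ replicate n y → x ≡ y
replicate-injective {n = n} {x} {y} eq = begin
  x                        ≡⟨ sym (lookup-replicate i x) ⟩
  lookup (replicate n x) i ≡⟨ cong (λ v → lookup v i) eq ⟩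
  lookup (replicate n y) i ≡⟨ lookup-replicate i y ⟩
  y                        ∎
  where
    i : Fin n
    i = fromℕ< (>-nonZero⁻¹ n)

replicate-++ : ∀ {A : Set} m {n} (x : A) → replicate m x ++ replicate n x ≡ replicate (m + n) x
replicate-++ zero    x = refl
replicate-++ (suc m) x = cong (x ∷_) (replicate-++ m x)

⊕-comm : ∀ {n} (u v : Vec Bool n) → u ⊕ v ≡ v ⊕ u
⊕-comm = zipWith-comm xor-comm

⊕-self : ∀ {n} (v : Vec Bool n) → v ⊕ v ≡ zeros
⊕-self []      = refl
⊕-self (x ∷ v) = cong₂ _∷_ (xor-same x) (⊕-self v)

≡⇒⊕≡zeros : ∀ {n} {u v : Vec Bool n} → u ≡ v → u ⊕ v ≡ zeros
≡⇒⊕≡zeros {u = u} refl = ⊕-self u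

⊕≡zeros⇒≡ : ∀ {n} {u v : Vec Bool n} → u ⊕ v ≡ zeros → u ≡ v
⊕≡zeros⇒≡ {u = []}    {[]}    _  = refl
⊕≡zeros⇒≡ {u = x ∷ u} {y ∷ v} eq =
  cong₂ _∷_ (xor≡false⇒≡ (∷-injectiveˡ eq)) (⊕≡zeros⇒≡ (∷-injectiveʳ eq))

tabulate-xor : ∀ {n} (f g : Fin n → Bool) → tabulate (λ i → f i xor g i) ≡ tabulate f ⊕ tabulate g
tabulate-xor {zero}  f g = refl
tabulate-xor {suc n} f g =
  cong ((f Fin.zero xor g Fin.zero) ∷_) (tabulate-xor (λ i → f (Fin.suc i)) (λ i → g (Fin.suc i)))

SwapInjective : ∀ {m} → (Vec Bool (m + m) → Vec Bool m) → Set
SwapInjective {m} F = ∀ (x y x′ y′ : Vec Bool m) →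
  F (x ++ y) ≡ F (x′ ++ y′) → F (y ++ x) ≡ F (y′ ++ x′) → x ≡ x′ × y ≡ y′

selfOrthogonal⇔swapInjective : ∀ {m} (φ : Vec Bool m ↔ Fin (2 ^ m)) (F : Vec Bool (m + m) → Vec Bool m) →
                               SelfOrthogonal φ F ⇔ SwapInjective F
selfOrthogonal⇔swapInjective φ F = mk⇔ selfOrthogonal⇒ ⇒selfOrthogonal
  where
    open Inverse φ

    to-injective : ∀ {x y} → to x ≡ to y → x ≡ y
    to-injective = Injection.injective (↔⇒↣ φ)

    from-injective : ∀ {i j} → from i ≡ from j → i ≡ j
    from-injective = Injection.injective (↔⇒↣ (↔-sym φ))

    Cayley-to : ∀ x y → Cayley φ F (to x) (to y) ≡ to (F (x ++ y))
    Cayley-to x y = cong₂ (λ u w → to (F (u ++ w))) (strictlyInverseʳ x) (strictlyInverseʳ y)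

    Cayley-to-cong : ∀ {x y x′ y′} → F (x ++ y) ≡ F (x′ ++ y′) →
                     Cayley φ F (to x) (to y) ≡ Cayley φ F (to x′) (to y′)
    Cayley-to-cong {x} {y} {x′} {y′} eq =
      trans (Cayley-to x y) (trans (cong to eq) (sym (Cayley-to x′ y′)))

    selfOrthogonal⇒ : SelfOrthogonal φ F → SwapInjective F
    selfOrthogonal⇒ so x y x′ y′ eq₁ eq₂ = to-injective (cong proj₁ cells≡) , to-injective (cong proj₂ cells≡)
      where
        cells≡ : (to x , to y) ≡ (to x′ , to y′)
        cells≡ = so (to x) (to y) (to x′) (to y′) (cong₂ _,_ (Cayley-to-cong eq₁) (Cayley-to-cong eq₂))

    ⇒selfOrthogonal : SwapInjective F → SelfOrthogonal φ F
    ⇒selfOrthogonal inj i j i′ j′ eq = cong₂ _,_ (from-injective (proj₁ xy≡)) (from-injective (proj₂ xy≡))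
      where
        xy≡ : from i ≡ from i′ × from j ≡ from j′
        xy≡ = inj (from i) (from j) (from i′) (from j′) (to-injective (cong proj₁ eq)) (to-injective (cong proj₂ eq))

module _ {m} {F : Vec Bool (m + m) → Vec Bool m} (F-⊕ : ∀ v w → F (v ⊕ w) ≡ F v ⊕ F w) where

  private
    collision⇒kernel : ∀ (x y x′ y′ : Vec Bool m) → F (x ++ y) ≡ F (x′ ++ y′) →
                       F ((x ⊕ x′) ++ (y ⊕ y′)) ≡ zeros
    collision⇒kernel x y x′ y′ eq = begin
      F ((x ⊕ x′) ++ (y ⊕ y′))      ≡⟨ cong F (sym (zipWith-++ _xor_ x y x′ y′)) ⟩
      F ((x ++ y) ⊕ (x′ ++ y′))     ≡⟨ F-⊕ (x ++ y) (x′ ++ y′) ⟩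
      F (x ++ y) ⊕ F (x′ ++ y′)     ≡⟨ ≡⇒⊕≡zeros eq ⟩
      zeros                         ∎

  diagonal-kernel⇒swapInjective : (∀ e → F (e ++ e) ≡ zeros → e ≡ zeros) → SwapInjective F
  diagonal-kernel⇒swapInjective kernel x y x′ y′ eq₁ eq₂ = ⊕≡zeros⇒≡ u≡0 , ⊕≡zeros⇒≡ v≡0
    where
      u v : Vec Bool m
      u = x ⊕ x′
      v = y ⊕ y′

      F[u‖v]≡0 : F (u ++ v) ≡ zeros
      F[u‖v]≡0 = collision⇒kernel x y x′ y′ eq₁

      F[v‖u]≡0 : F (v ++ u) ≡ zeros
      F[v‖u]≡0 = collision⇒kernel y x y′ x′ eq₂

      u≡v : u ≡ v
      u≡v = ⊕≡zeros⇒≡ (kernel (u ⊕ v) (begin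
        F ((u ⊕ v) ++ (u ⊕ v))        ≡⟨ cong (λ w → F ((u ⊕ v) ++ w)) (⊕-comm u v) ⟩
        F ((u ⊕ v) ++ (v ⊕ u))        ≡⟨ collision⇒kernel u v v u (trans F[u‖v]≡0 (sym F[v‖u]≡0)) ⟩
        zeros                         ∎))

      u≡0 : u ≡ zeros
      u≡0 = kernel u (subst (λ w → F (u ++ w) ≡ zeros) (sym u≡v) F[u‖v]≡0)

      v≡0 : v ≡ zeros
      v≡0 = trans (sym u≡v) u≡0

infix 7 _·_

-- linearRule a is definitionally a ·_; _·_ also covers length 0, which the induction needs.
_·_ : ∀ {n} → Vec Bool n → Vec Bool n → Bool
a · x = foldr (λ _ → Bool) _xor_ false (zipWith _∧_ a x)

·-⊕ : ∀ {n} (a x y : Vec Bool n) → a · (x ⊕ y) ≡ (a · x) xor (a · y)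
·-⊕ []      []       []       = refl
·-⊕ (c ∷ a) (x ∷ xs) (y ∷ ys) = begin
  (c ∧ (x xor y)) xor a · (xs ⊕ ys)                 ≡⟨ cong₂ _xor_ (∧-distribˡ-xor c x y) (·-⊕ a xs ys) ⟩
  ((c ∧ x) xor (c ∧ y)) xor ((a · xs) xor (a · ys)) ≡⟨ 𝔽₂-+.interchange (c ∧ x) (c ∧ y) (a · xs) (a · ys) ⟩
  ((c ∧ x) xor a · xs) xor ((c ∧ y) xor a · ys)     ∎

window-⊕ : ∀ {m} (v w : Vec Bool (m + m)) (i : Fin m) → window (v ⊕ w) i ≡ window v i ⊕ window w i
window-⊕ {m} v w i =
  trans (tabulate-cong (λ j → lookup-zipWith _xor_ (cell j) v w))
        (tabulate-xor (λ j → lookup v (cell j)) (λ j → lookup w (cell j)))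
  where
    cell : Fin (suc m) → Fin (m + m)
    cell j = fromℕ< (+-mono-<-≤ (toℕ<n i) (toℕ≤pred[n] j))

NBCA-⊕ : ∀ {m} (a : Vec Bool (suc m)) (v w : Vec Bool (m + m)) →
         NBCA (linearRule a) (v ⊕ w) ≡ NBCA (linearRule a) v ⊕ NBCA (linearRule a) w
NBCA-⊕ a v w = begin
  tabulate (λ i → a · window (v ⊕ w) i)                   ≡⟨ tabulate-cong (λ i → cong (a ·_) (window-⊕ v w i)) ⟩
  tabulate (λ i → a · (window v i ⊕ window w i))          ≡⟨ tabulate-cong (λ i → ·-⊕ a (window v i) (window w i)) ⟩
  tabulate (λ i → (a · window v i) xor (a · window w i))  ≡⟨ tabulate-xor _ _ ⟩
  NBCA (linearRule a) v ⊕ NBCA (linearRule a) w           ∎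

-- act p s h is p(σˢ) h for the left shift (σ h) k = h (k + 1): its i-th term is ⊕ⱼ pⱼ h (i + j s).
act : List Bool → ℕ → (ℕ → Bool) → ℕ → Bool
act []       s h i = false
act (c ∷ cs) s h i = (c ∧ h i) xor act cs s h (i + s)

act-cong : ∀ p s {h h′} → (∀ k → h k ≡ h′ k) → ∀ i → act p s h i ≡ act p s h′ i
act-cong []       s h≗h′ i = refl
act-cong (c ∷ cs) s h≗h′ i = cong₂ (λ x y → (c ∧ x) xor y) (h≗h′ i) (act-cong cs s h≗h′ (i + s))

act-xor : ∀ p s u v i → act p s (λ k → u k xor v k) i ≡ act p s u i xor act p s v i
act-xor []       s u v i = refl
act-xor (c ∷ cs) s u v i = begin
  (c ∧ (u i xor v i)) xor act cs s (λ k → u k xor v k) (i + s)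
    ≡⟨ cong₂ _xor_ (∧-distribˡ-xor c (u i) (v i)) (act-xor cs s u v (i + s)) ⟩
  ((c ∧ u i) xor (c ∧ v i)) xor (act cs s u (i + s) xor act cs s v (i + s))
    ≡⟨ 𝔽₂-+.interchange (c ∧ u i) (c ∧ v i) _ _ ⟩
  ((c ∧ u i) xor act cs s u (i + s)) xor ((c ∧ v i) xor act cs s v (i + s))
    ∎

act-shift : ∀ p s u r i → act p s (λ k → u (k + r)) i ≡ act p s u (i + r)
act-shift []       s u r i = refl
act-shift (c ∷ cs) s u r i =
  cong ((c ∧ u (i + r)) xor_)
       (trans (act-shift cs s u r (i + s)) (cong (act cs s u) (ℕ-+.xy∙z≈xz∙y i s r)))

act-periodic : ∀ p s h → (∀ k → h (k + s) ≡ h k) → ∀ i → act p s h i ≡ polyEval p true ∧ h i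
act-periodic []       s h h-per i = refl
act-periodic (c ∷ cs) s h h-per i = begin
  (c ∧ h i) xor act cs s h (i + s)               ≡⟨ cong ((c ∧ h i) xor_) (act-periodic cs s h h-per (i + s)) ⟩
  (c ∧ h i) xor (polyEval cs true ∧ h (i + s))  ≡⟨ cong (λ x → (c ∧ h i) xor (polyEval cs true ∧ x)) (h-per i) ⟩
  (c ∧ h i) xor (polyEval cs true ∧ h i)        ≡⟨ sym (∧-distribʳ-xor (h i) c (polyEval cs true)) ⟩
  (c xor polyEval cs true) ∧ h i                ∎

act-false : ∀ p s i → act p s (λ _ → false) i ≡ false
act-false p s i = trans (act-periodic p s _ (λ _ → refl) i) (∧-zeroʳ (polyEval p true))

act-∧ : ∀ p s c u i → act p s (λ k → c ∧ u k) i ≡ c ∧ act p s u i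
act-∧ p s false u i = act-false p s i
act-∧ p s true  u i = refl

act-preserves-period : ∀ p s {h} r → (∀ k → h (k + r) ≡ h k) → ∀ k → act p s h (k + r) ≡ act p s h k
act-preserves-period p s {h} r h-per k = trans (sym (act-shift p s h r k)) (act-cong p s h-per k)

act-frobenius : ∀ p s h i → act p s (act p s h) i ≡ act p (s + s) h i
act-frobenius []       s h i = refl
act-frobenius (c ∷ cs) s h i = begin
  Y xor act cs s (λ k → (c ∧ h k) xor act cs s h (k + s)) (i + s)
    ≡⟨ cong (Y xor_) (act-xor cs s (λ k → c ∧ h k) (λ k → act cs s h (k + s)) (i + s)) ⟩
  Y xor (act cs s (λ k → c ∧ h k) (i + s) xor act cs s (λ k → act cs s h (k + s)) (i + s))
    ≡⟨ cong₂ (λ x y → Y xor (x xor y)) (act-∧ cs s c h (i + s)) (act-shift cs s (act cs s h) s (i + s)) ⟩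
  Y xor ((c ∧ X) xor act cs s (act cs s h) (i + s + s))
    ≡⟨ cong₂ (λ x y → x xor ((c ∧ X) xor y)) (∧-distribˡ-xor-idem c (h i) X) (act-frobenius cs s h (i + s + s)) ⟩
  ((c ∧ h i) xor (c ∧ X)) xor ((c ∧ X) xor act cs (s + s) h (i + s + s))
    ≡⟨ xor-cancel-middle (c ∧ h i) (c ∧ X) _ ⟩
  (c ∧ h i) xor act cs (s + s) h (i + s + s)
    ≡⟨ cong (λ n → (c ∧ h i) xor act cs (s + s) h n) (+-assoc i s s) ⟩
  (c ∧ h i) xor act cs (s + s) h (i + (s + s))
    ∎
  where
    X Y : Bool
    X = act cs s h (i + s)
    Y = c ∧ ((c ∧ h i) xor X)

act-2^-kernel : ∀ p h → (∀ i → act p 1 h i ≡ false) → ∀ k i → act p (2 ^ k) h i ≡ false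
act-2^-kernel p h ker zero    i = ker i
act-2^-kernel p h ker (suc k) i = begin
  act p (2 ^ suc k) h i           ≡⟨ cong (λ s → act p s h i) (cong (2 ^ k +_) (+-identityʳ (2 ^ k))) ⟩
  act p (2 ^ k + 2 ^ k) h i       ≡⟨ sym (act-frobenius p (2 ^ k) h i) ⟩
  act p (2 ^ k) (act p (2 ^ k) h) i ≡⟨ act-cong p (2 ^ k) (act-2^-kernel p h ker k) i ⟩
  act p (2 ^ k) (λ _ → false) i   ≡⟨ act-false p (2 ^ k) i ⟩
  false                           ∎

periodic-kernel : ∀ p t h → polyEval p true ≡ true → (∀ k → h (k + 2 ^ t) ≡ h k) →
                  (∀ i → act p 1 h i ≡ false) → ∀ i → h i ≡ false
periodic-kernel p t h p[1]≡1 h-per ker i = begin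
  h i                       ≡⟨ cong (_∧ h i) (sym p[1]≡1) ⟩
  polyEval p true ∧ h i     ≡⟨ sym (act-periodic p (2 ^ t) h h-per i) ⟩
  act p (2 ^ t) h i         ≡⟨ act-2^-kernel p h ker t i ⟩
  false                     ∎

periodic⇒≡% : ∀ {A : Set} {m} .{{_ : NonZero m}} (h : ℕ → A) → (∀ k → h (k + m) ≡ h k) →
              ∀ k → h k ≡ h (k % m)
periodic⇒≡% {m = m} h h-per k = trans (cong h (m≡m%n+[m/n]*n k m)) (drop-periods (k % m) (k / m))
  where
    drop-periods : ∀ r q → h (r + q * m) ≡ h r
    drop-periods r zero    = cong h (+-identityʳ r)
    drop-periods r (suc q) =
      trans (cong h (ℕ-+.x∙yz≈xz∙y r m (q * m))) (trans (h-per (r + q * m)) (drop-periods r q))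

cycle : ∀ {A : Set} {m} .{{_ : NonZero m}} → Vec A m → ℕ → A
cycle {m = m} v k = lookup v (k mod m)

module _ {A : Set} {m} .{{_ : NonZero m}} (v : Vec A m) where

  cycle-periodic : ∀ k → cycle v (k + m) ≡ cycle v k
  cycle-periodic k = cong (lookup v) (fromℕ<-cong _ _ ([m+n]%n≡m%n k m) _ _)

  cycle-toℕ : ∀ i → cycle v (toℕ i) ≡ lookup v i
  cycle-toℕ i =
    cong (lookup v) (trans (fromℕ<-cong _ _ (m<n⇒m%n≡m (toℕ<n i)) _ _) (fromℕ<-toℕ i (toℕ<n i)))

  lookup-++-cycle : ∀ i → lookup (v ++ v) i ≡ cycle v (toℕ i)
  lookup-++-cycle i =
    subst (λ j → lookup (v ++ v) j ≡ cycle v (toℕ j)) (join-splitAt m m i) (halves (splitAt m i))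
    where
      halves : ∀ (j : Fin m ⊎ Fin m) → lookup (v ++ v) (join m m j) ≡ cycle v (toℕ (join m m j))
      halves (inj₁ j) = begin
        lookup (v ++ v) (j Fin.↑ˡ m)       ≡⟨ lookup-++ˡ v v j ⟩
        lookup v j                         ≡⟨ sym (cycle-toℕ j) ⟩
        cycle v (toℕ j)                    ≡⟨ cong (cycle v) (sym (toℕ-↑ˡ j m)) ⟩
        cycle v (toℕ (j Fin.↑ˡ m))         ∎
      halves (inj₂ j) = begin
        lookup (v ++ v) (m Fin.↑ʳ j)       ≡⟨ lookup-++ʳ v v j ⟩
        lookup v j                         ≡⟨ sym (cycle-toℕ j) ⟩
        cycle v (toℕ j)                    ≡⟨ sym (cycle-periodic (toℕ j)) ⟩
        cycle v (toℕ j + m)                ≡⟨ cong (cycle v) (+-comm (toℕ j) m) ⟩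
        cycle v (m + toℕ j)                ≡⟨ cong (cycle v) (sym (toℕ-↑ʳ m j)) ⟩
        cycle v (toℕ (m Fin.↑ʳ j))         ∎

·-tabulate : ∀ {n} (a : Vec Bool n) (g : Fin n → Bool) (h : ℕ → Bool) i →
             (∀ j → g j ≡ h (i + toℕ j)) → a · tabulate g ≡ act (toList a) 1 h i
·-tabulate []      g h i g≗h = refl
·-tabulate (c ∷ a) g h i g≗h =
  cong₂ (λ x y → (c ∧ x) xor y)
        (trans (g≗h Fin.zero) (cong h (+-identityʳ i)))
        (·-tabulate a (λ j → g (Fin.suc j)) h (i + 1)
                    (λ j → trans (g≗h (Fin.suc j)) (cong h (sym (+-assoc i 1 (toℕ j))))))

NBCA-lookup : ∀ {m} (a : Vec Bool (suc m)) (v : Vec Bool (m + m)) (h : ℕ → Bool) →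
              (∀ k → lookup v k ≡ h (toℕ k)) →
              ∀ i → lookup (NBCA (linearRule a) v) i ≡ act (toList a) 1 h (toℕ i)
NBCA-lookup a v h v≗h i =
  trans (lookup∘tabulate _ i)
        (·-tabulate a _ h (toℕ i)
                    (λ j → trans (v≗h _) (cong h (toℕ-fromℕ< (+-mono-<-≤ (toℕ<n i) (toℕ≤pred[n] j))))))

NBCA-constant : ∀ {m} (a : Vec Bool (suc m)) b →
                NBCA (linearRule a) (replicate m b ++ replicate m b) ≡ replicate m (polyEval (toList a) true ∧ b)
NBCA-constant {m} a b = lookup-extensional λ i → begin
  lookup (NBCA (linearRule a) (b̄ ++ b̄)) i
    ≡⟨ NBCA-lookup a (b̄ ++ b̄) (λ _ → b) (λ k → trans (cong (λ v → lookup v k) (replicate-++ m b)) (lookup-replicate k b)) i ⟩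
  act (toList a) 1 (λ _ → b) (toℕ i)
    ≡⟨ act-periodic (toList a) 1 (λ _ → b) (λ _ → refl) (toℕ i) ⟩
  polyEval (toList a) true ∧ b
    ≡⟨ sym (lookup-replicate i _) ⟩
  lookup (replicate m (polyEval (toList a) true ∧ b)) i
    ∎
  where
    b̄ : Vec Bool m
    b̄ = replicate m b

diagonal-kernel : ∀ t (a : Vec Bool (suc (2 ^ t))) → polyEval (toList a) true ≡ true →
                  ∀ e → NBCA (linearRule a) (e ++ e) ≡ zeros → e ≡ zeros
diagonal-kernel t a p[1]≡1 e F[e‖e]≡0 = lookup-extensional λ j → begin
  lookup e j       ≡⟨ sym (cycle-toℕ e j) ⟩
  cycle e (toℕ j)  ≡⟨ periodic-kernel p t (cycle e) p[1]≡1 (cycle-periodic e) p[σ]e≡0 (toℕ j) ⟩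
  false            ≡⟨ sym (lookup-replicate j false) ⟩
  lookup zeros j   ∎
  where
    p : List Bool
    p = toList a

    N : ℕ
    N = 2 ^ t

    instance
      N≢0 : NonZero N
      N≢0 = m^n≢0 2 t

    p[σ]e≡0-below-N : ∀ i → act p 1 (cycle e) (toℕ i) ≡ false
    p[σ]e≡0-below-N i = begin
      act p 1 (cycle e) (toℕ i)               ≡⟨ sym (NBCA-lookup a (e ++ e) (cycle e) (lookup-++-cycle e) i) ⟩
      lookup (NBCA (linearRule a) (e ++ e)) i ≡⟨ cong (λ v → lookup v i) F[e‖e]≡0 ⟩
      lookup zeros i                          ≡⟨ lookup-replicate i false ⟩
      false                                   ∎

    p[σ]e≡0 : ∀ k → act p 1 (cycle e) k ≡ false
    p[σ]e≡0 k = begin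
      act p 1 (cycle e) k                 ≡⟨ periodic⇒≡% _ (act-preserves-period p 1 N (cycle-periodic e)) k ⟩
      act p 1 (cycle e) (k % N)           ≡⟨ cong (act p 1 (cycle e)) (sym (toℕ-fromℕ< (m%n<n k N))) ⟩
      act p 1 (cycle e) (toℕ (k mod N))   ≡⟨ p[σ]e≡0-below-N (k mod N) ⟩
      false                               ∎

p[1]≢0⇒swapInjective : ∀ t (a : Vec Bool (suc (2 ^ t))) →
                       polyEval (toList a) true ≢ false → SwapInjective (NBCA (linearRule a))
p[1]≢0⇒swapInjective t a p[1]≢0 =
  diagonal-kernel⇒swapInjective (NBCA-⊕ a) (diagonal-kernel t a (¬-not p[1]≢0))

swapInjective⇒p[1]≢0 : ∀ {m} .{{_ : NonZero m}} (a : Vec Bool (suc m)) →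
                       SwapInjective (NBCA (linearRule a)) → polyEval (toList a) true ≢ false
swapInjective⇒p[1]≢0 {m} a inj p[1]≡0 =
  true≢false (replicate-injective (proj₁ (inj ones ones zeros zeros F≡ F≡)))
  where
    ones : Vec Bool m
    ones = replicate m true

    F≡ : NBCA (linearRule a) (ones ++ ones) ≡ NBCA (linearRule a) (zeros {m} ++ zeros)
    F≡ = begin
      NBCA (linearRule a) (ones ++ ones)                 ≡⟨ NBCA-constant a true ⟩
      replicate m (polyEval (toList a) true ∧ true)      ≡⟨ cong (λ c → replicate m (c ∧ true)) p[1]≡0 ⟩
      replicate m false                                  ≡⟨ cong (λ c → replicate m (c ∧ false)) (sym p[1]≡0) ⟩
      replicate m (polyEval (toList a) true ∧ false)     ≡⟨ sym (NBCA-constant a false) ⟩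
      NBCA (linearRule a) (zeros {m} ++ zeros)           ∎

    true≢false : true ≢ false
    true≢false ()

lemma4 : (t : ℕ) (a : Vec Bool (suc (2 ^ t))) (φ : Vec Bool (2 ^ t) ↔ Fin (2 ^ (2 ^ t))) →
         Bipermutive (linearRule a) →
         (SelfOrthogonal φ (NBCA (linearRule a)) ⇔ (polyEval (assocPoly a) true ≢ false))
lemma4 t a φ _ =
  mk⇔ (swapInjective⇒p[1]≢0 {{m^n≢0 2 t}} a) (p[1]≢0⇒swapInjective t a)
    ⇔-∘ selfOrthogonal⇔swapInjective φ (NBCA (linearRule a))
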